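{- Let $G$ be a finite simple undirected graph and let $H$ be obtained from $G$ by inserting a new vertex $v$ with an arbitrary neighborhood $N(v)\subseteq V_G$ (i.e. $H=(V_G\cup\{v\},E_G\cup\{\{v,v'\}:v'\in N(v)\})$). Then \[\operatorname{nlcw}(G)\le\operatorname{nlcw}(H)\le 2\operatorname{nlcw}(G)\quad\text{and}\quad \operatorname{cw}(G)\le\operatorname{cw}(H)\le 2\operatorname{cw}(G).\]
   Context: Clique-width: for a positive integer $k$, $\mathrm{CW}_k$ is the smallest class of graphs whose vertices carry labels from $\{1,\dots,k\}$ that contains every single-vertex graph with any label and is closed under: disjoint union; relabeling $\rho_{a\to b}$ for $a\neq b$; and $\eta_{a,b}$ for $a\neq b$ (add all edges between vertices labeled $a$ and vertices labeled $b$). $\operatorname{cw}(G)$ is the least $k$ such that some labeling of $G$ lies in $\mathrm{CW}_k$. NLC-width: $\mathrm{NLC}_k$ is the smallest class of labeled graphs (labels in $\{1,\dots,k\}$) containing every single-vertex graph with any label and closed under: $G\times_S J$ for $S\subseteq\{1,\dots,k\}^2$ (disjoint union of vertex-disjoint $G$ and $J$ plus all edges $\{u,v\}$, $u\in V_G$, $v\in V_J$, $(\mathrm{lab}(u),\mathrm{lab}(v))\in S$); and $\circ_R$ for $R:\{1,\dots,k\}\to\{1,\dots,k\}$. $\operatorname{nlcw}(G)$ is the least $k$ such that some labeling of $G$ lies in $\mathrm{NLC}_k$. -}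

module Defs where

open import Data.Nat using (ℕ; zero; suc; _+_; _*_; _≤_)
open import Data.Fin using (Fin; zero; suc; splitAt; _≟_)
open import Data.Bool using (Bool; true; false; _∧_; _∨_; if_then_else_)
open import Data.Sum using (_⊎_; inj₁; inj₂)
open import Data.Product using (Σ; _×_; _,_)
open import Relation.Nullary using (¬_; does)
open import Relation.Binary.PropositionalEquality using (_≡_; _≢_; refl)
open import Function.Bundles using (_⤖_; Bijection)

record Graph : Set where
  field
    size   : ℕ
    adj    : Fin size → Fin size → Bool
    sym    : ∀ i j → adj i j ≡ adj j i
    irrefl : ∀ i → adj i i ≡ false

open Graph public

-- H = G plus a new vertex (vertex zero) adjacent exactly to N ⊆ V_G.
addAdj : {n : ℕ} → (Fin n → Fin n → Bool) → (Fin n → Bool) →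
         Fin (suc n) → Fin (suc n) → Bool
addAdj A N zero    zero    = false
addAdj A N zero    (suc j) = N j
addAdj A N (suc i) zero    = N i
addAdj A N (suc i) (suc j) = A i j

addVertex : (G : Graph) → (Fin (size G) → Bool) → Graph
addVertex G N = record
  { size = suc (size G)
  ; adj = addAdj (adj G) N
  ; sym = s
  ; irrefl = r }
  where
  s : ∀ i j → addAdj (adj G) N i j ≡ addAdj (adj G) N j i
  s zero    zero    = refl
  s zero    (suc j) = refl
  s (suc i) zero    = refl
  s (suc i) (suc j) = Graph.sym G i j
  r : ∀ i → addAdj (adj G) N i i ≡ false
  r zero    = refl
  r (suc i) = Graph.irrefl G i

record IsoTo (G : Graph) (m : ℕ) (B : Fin m → Fin m → Bool) : Set where
  field
    bij  : Fin (size G) ⤖ Fin m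
    pres : ∀ i j → adj G i j ≡ B (Bijection.to bij i) (Bijection.to bij j)

_==_ : {k : ℕ} → Fin k → Fin k → Bool
a == b = does (a ≟ b)

unionAdj : {m n : ℕ} → (Fin m → Fin m → Bool) → (Fin n → Fin n → Bool) →
           Fin (m + n) → Fin (m + n) → Bool
unionAdj {m} A B i j with splitAt m i | splitAt m j
... | inj₁ i' | inj₁ j' = A i' j'
... | inj₂ i' | inj₂ j' = B i' j'
... | _       | _       = false

unionLab : {k m n : ℕ} → (Fin m → Fin k) → (Fin n → Fin k) → Fin (m + n) → Fin k
unionLab {m = m} l r i with splitAt m i
... | inj₁ i' = l i'
... | inj₂ i' = r i'

data CWExpr (k : ℕ) : Set where
  vtx  : Fin k → CWExpr k
  _⊕_  : CWExpr k → CWExpr k → CWExpr k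
  ρ    : (a b : Fin k) → a ≢ b → CWExpr k → CWExpr k
  η    : (a b : Fin k) → a ≢ b → CWExpr k → CWExpr k

cwSize : {k : ℕ} → CWExpr k → ℕ
cwSize (vtx a)     = 1
cwSize (e ⊕ f)     = cwSize e + cwSize f
cwSize (ρ a b _ e) = cwSize e
cwSize (η a b _ e) = cwSize e

cwLab : {k : ℕ} (e : CWExpr k) → Fin (cwSize e) → Fin k
cwLab (vtx a)     _ = a
cwLab (e ⊕ f)     i = unionLab (cwLab e) (cwLab f) i
cwLab (ρ a b _ e) i = if cwLab e i == a then b else cwLab e i
cwLab (η a b _ e) i = cwLab e i

cwAdj : {k : ℕ} (e : CWExpr k) → Fin (cwSize e) → Fin (cwSize e) → Bool
cwAdj (vtx a)     _ _ = false
cwAdj (e ⊕ f)     i j = unionAdj (cwAdj e) (cwAdj f) i j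
cwAdj (ρ a b _ e) i j = cwAdj e i j
cwAdj (η a b _ e) i j =
  cwAdj e i j ∨ ((cwLab e i == a ∧ cwLab e j == b) ∨ (cwLab e i == b ∧ cwLab e j == a))

InCW : Graph → ℕ → Set
InCW G k = Σ (CWExpr k) λ e → IsoTo G (cwSize e) (cwAdj e)

IsCW : Graph → ℕ → Set
IsCW G c = InCW G c × (∀ k → InCW G k → c ≤ k)

data NLCExpr (k : ℕ) : Set where
  vtx  : Fin k → NLCExpr k
  join : (S : Fin k → Fin k → Bool) → NLCExpr k → NLCExpr k → NLCExpr k
  relab : (R : Fin k → Fin k) → NLCExpr k → NLCExpr k

nlcSize : {k : ℕ} → NLCExpr k → ℕ
nlcSize (vtx a)      = 1
nlcSize (join S e f) = nlcSize e + nlcSize f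
nlcSize (relab R e)  = nlcSize e

nlcLab : {k : ℕ} (e : NLCExpr k) → Fin (nlcSize e) → Fin k
nlcLab (vtx a)      _ = a
nlcLab (join S e f) i = unionLab (nlcLab e) (nlcLab f) i
nlcLab (relab R e)  i = R (nlcLab e i)

nlcAdj : {k : ℕ} (e : NLCExpr k) → Fin (nlcSize e) → Fin (nlcSize e) → Bool
nlcAdj (vtx a)      _ _ = false
nlcAdj (join S e f) i j with splitAt (nlcSize e) i | splitAt (nlcSize e) j
... | inj₁ i' | inj₁ j' = nlcAdj e i' j'
... | inj₂ i' | inj₂ j' = nlcAdj f i' j'
... | inj₁ i' | inj₂ j' = S (nlcLab e i') (nlcLab f j')
... | inj₂ i' | inj₁ j' = S (nlcLab e j') (nlcLab f i')
nlcAdj (relab R e)  i j = nlcAdj e i j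

InNLC : Graph → ℕ → Set
InNLC G k = Σ (NLCExpr k) λ e → IsoTo G (nlcSize e) (nlcAdj e)

IsNLCW : Graph → ℕ → Set
IsNLCW G c = InNLC G c × (∀ k → InNLC G k → c ≤ k)

{-# OPTIONS --safe #-}
-- Deleting a vertex from a k-expression (CW or NLC) commutes with every operation, so an
-- expression for H restricts to one for G = H - v: hence cw(G) <= cw(H) and nlcw(G) <= nlcw(H).
-- Conversely, give every vertex u of G the label (s, a), where a is its label in a k-expression
-- for G and s records whether u is adjacent to v, and let every operation act on a alone; this
-- 2k-expression still denotes G. In NLC, v is then attached by one join that reads off s. In CW,
-- merging all labels (s, a) into (s, 0) frees a label for v when k >= 2, and v is joined to the
-- class (true, 0); when k = 1, G is edgeless and H is a star plus isolated vertices.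
module Submission where

open import Defs hiding (sym)
open import Data.Bool using (Bool; true; false; _∧_; _∨_; if_then_else_)
import Data.Bool as Bool
open import Data.Bool.Properties using (∨-identityʳ; ∧-identityʳ; ∧-zeroʳ)
open import Data.Bool.Solver using (module ∨-∧-Solver)
open import Data.Empty using (⊥-elim)
open import Data.Fin using (Fin; zero; suc; splitAt; _↑ˡ_; _↑ʳ_; _≟_; combine; remQuot)
import Data.Fin as Fin
open import Data.Fin.Properties
  using (splitAt-↑ˡ; splitAt-↑ʳ; ↑ˡ-injective; ↑ʳ-injective; suc-injective; any?; remQuot-combine; combine-injective)
open import Data.List using (List; []; _∷_; allFin)
open import Data.List.Membership.Propositional using (_∈_)
open import Data.List.Membership.Propositional.Properties using (∈-allFin)
open import Data.List.Relation.Unary.Any using (here; there)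
open import Data.Nat using (ℕ; zero; suc; _+_; _*_; _≤_)
open import Data.Product using (∃; _×_; _,_; proj₁; proj₂)
import Data.Product as Product
open import Data.Sum using (_⊎_; inj₁; inj₂)
import Data.Sum as Sum
open import Function using (_∘_)
open import Function.Bundles using (mk⤖; Bijection; Inverse)
open import Function.Definitions using (Injective)
open import Function.Properties.Bijection using (⤖⇒↔)
open import Level using (0ℓ)
open import Relation.Binary.PropositionalEquality
open import Relation.Nullary using (¬_; yes; no; does)
open import Relation.Nullary.Decidable using (dec-true; dec-false)
open import Relation.Unary using (Pred; Decidable; Empty)

data Side (m n : ℕ) : Fin (m + n) → Set where
  left  : (x : Fin m) → Side m n (x ↑ˡ n)
  right : (y : Fin n) → Side m n (m ↑ʳ y)

side : ∀ m n i → Side m n i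
side zero    n i       = right i
side (suc m) n zero    = left zero
side (suc m) n (suc i) with side m n i
... | left x  = left (suc x)
... | right y = right y

↑ˡ≢↑ʳ : ∀ {m n} (x : Fin m) (y : Fin n) → x ↑ˡ n ≢ m ↑ʳ y
↑ˡ≢↑ʳ {m} {n} x y eq with trans (sym (splitAt-↑ˡ m x n)) (trans (cong (splitAt m) eq) (splitAt-↑ʳ m n y))
... | ()

_⊕ᶠ_ : ∀ {m m' n n'} → (Fin m → Fin m') → (Fin n → Fin n') → Fin (m + n) → Fin (m' + n')
_⊕ᶠ_ {m} {m'} {n} {n'} f g = Fin.join m' n' ∘ Sum.map f g ∘ splitAt m

module _ {m m' n n'} (f : Fin m → Fin m') (g : Fin n → Fin n') where

  ⊕ᶠ-↑ˡ : ∀ x → (f ⊕ᶠ g) (x ↑ˡ n) ≡ f x ↑ˡ n'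
  ⊕ᶠ-↑ˡ x = cong (Fin.join m' n' ∘ Sum.map f g) (splitAt-↑ˡ m x n)

  ⊕ᶠ-↑ʳ : ∀ y → (f ⊕ᶠ g) (m ↑ʳ y) ≡ m' ↑ʳ g y
  ⊕ᶠ-↑ʳ y = cong (Fin.join m' n' ∘ Sum.map f g) (splitAt-↑ʳ m n y)

  ⊕ᶠ-injective : Injective _≡_ _≡_ f → Injective _≡_ _≡_ g → Injective _≡_ _≡_ (f ⊕ᶠ g)
  ⊕ᶠ-injective f-inj g-inj {i} {j} = go (side m n i) (side m n j)
    where
    go : ∀ {i j} → Side m n i → Side m n j → (f ⊕ᶠ g) i ≡ (f ⊕ᶠ g) j → i ≡ j
    go (left x)  (left y)  eq =
      cong (_↑ˡ n) (f-inj (↑ˡ-injective n' _ _ (trans (sym (⊕ᶠ-↑ˡ x)) (trans eq (⊕ᶠ-↑ˡ y)))))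
    go (right x) (right y) eq =
      cong (m ↑ʳ_) (g-inj (↑ʳ-injective m' _ _ (trans (sym (⊕ᶠ-↑ʳ x)) (trans eq (⊕ᶠ-↑ʳ y)))))
    go (left x)  (right y) eq = ⊥-elim (↑ˡ≢↑ʳ _ _ (trans (sym (⊕ᶠ-↑ˡ x)) (trans eq (⊕ᶠ-↑ʳ y))))
    go (right x) (left y)  eq = ⊥-elim (↑ˡ≢↑ʳ _ _ (trans (sym (⊕ᶠ-↑ˡ y)) (trans (sym eq) (⊕ᶠ-↑ʳ x))))

record LabelledGraph (k : ℕ) : Set where
  constructor labelled
  field
    order : ℕ
    edge  : Fin order → Fin order → Bool
    label : Fin order → Fin k

open LabelledGraph

private
  variable
    k : ℕ
    F G H G' H' : LabelledGraph k

point : Fin k → LabelledGraph k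
point a = labelled 1 (λ _ _ → false) (λ _ → a)

unary : (Bool → Fin k → Fin k → Bool) → (Fin k → Fin k) → LabelledGraph k → LabelledGraph k
unary Φ Ψ G = labelled (order G) (λ x y → Φ (edge G x y) (label G x) (label G y)) (Ψ ∘ label G)

record _↪_ (G H : LabelledGraph k) : Set where
  field
    map           : Fin (order G) → Fin (order H)
    map-injective : Injective _≡_ _≡_ map
    map-edge      : ∀ x y → edge G x y ≡ edge H (map x) (map y)
    map-label     : ∀ x → label G x ≡ label H (map x)

open _↪_

↪-refl : G ↪ G
↪-refl = record { map = λ x → x ; map-injective = λ eq → eq ; map-edge = λ _ _ → refl ; map-label = λ _ → refl }

↪-trans : F ↪ G → G ↪ H → F ↪ H
↪-trans ι κ = record
  { map           = map κ ∘ map ι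
  ; map-injective = map-injective ι ∘ map-injective κ
  ; map-edge      = λ x y → trans (map-edge ι x y) (map-edge κ (map ι x) (map ι y))
  ; map-label     = λ x → trans (map-label ι x) (map-label κ (map ι x))
  }

↪-reshape : ∀ {E E'} {L : _ → Fin k} {L' : _ → Fin k} (ι : G ↪ H) →
            (∀ x y → E x y ≡ E' (map ι x) (map ι y)) → (∀ x → L x ≡ L' (map ι x)) →
            labelled (order G) E L ↪ labelled (order H) E' L'
↪-reshape ι e l = record { map = map ι ; map-injective = map-injective ι ; map-edge = e ; map-label = l }

record Join (G H : LabelledGraph k) (C : Fin k → Fin k → Bool) : Set where
  private
    m = order G
    n = order H
  field
    edges    : Fin (m + n) → Fin (m + n) → Bool
    labels   : Fin (m + n) → Fin k
    edges-ll : ∀ x y → edges (x ↑ˡ n) (y ↑ˡ n) ≡ edge G x y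
    edges-rr : ∀ x y → edges (m ↑ʳ x) (m ↑ʳ y) ≡ edge H x y
    edges-lr : ∀ x y → edges (x ↑ˡ n) (m ↑ʳ y) ≡ C (label G x) (label H y)
    edges-rl : ∀ x y → edges (m ↑ʳ y) (x ↑ˡ n) ≡ C (label G x) (label H y)
    labels-l : ∀ x → labels (x ↑ˡ n) ≡ label G x
    labels-r : ∀ y → labels (m ↑ʳ y) ≡ label H y

  graph : LabelledGraph k
  graph = labelled (m + n) edges labels

open Join using (graph)

module _ {C} (J : Join G H C) where
  open Join J hiding (graph)

  ↪-inl : G ↪ graph J
  ↪-inl = record
    { map           = _↑ˡ order H
    ; map-injective = ↑ˡ-injective (order H) _ _
    ; map-edge      = λ x y → sym (edges-ll x y)
    ; map-label     = λ x → sym (labels-l x)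
    }

  ↪-inr : H ↪ graph J
  ↪-inr = record
    { map           = order G ↑ʳ_
    ; map-injective = ↑ʳ-injective (order G) _ _
    ; map-edge      = λ x y → sym (edges-rr x y)
    ; map-label     = λ y → sym (labels-r y)
    }

↪-join : ∀ {C} (J : Join G H C) (J' : Join G' H' C) → G ↪ G' → H ↪ H' → graph J ↪ graph J'
↪-join {G = G} {H} {G'} {H'} {C = C} J J' ι κ = record
  { map           = f
  ; map-injective = ⊕ᶠ-injective (map ι) (map κ) (map-injective ι) (map-injective κ)
  ; map-edge      = λ x y → edge-map (side m n x) (side m n y)
  ; map-label     = λ x → label-map (side m n x)
  }
  where
  module J = Join J
  module J' = Join J'
  m n : ℕ
  m = order G
  n = order H
  f : Fin (m + n) → Fin (order G' + order H')
  f = map ι ⊕ᶠ map κ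
  edge-map : ∀ {x y} → Side m n x → Side m n y → J.edges x y ≡ J'.edges (f x) (f y)
  edge-map (left x) (left y)
    rewrite ⊕ᶠ-↑ˡ (map ι) (map κ) x | ⊕ᶠ-↑ˡ (map ι) (map κ) y
          | J.edges-ll x y | J'.edges-ll (map ι x) (map ι y) = map-edge ι x y
  edge-map (right x) (right y)
    rewrite ⊕ᶠ-↑ʳ (map ι) (map κ) x | ⊕ᶠ-↑ʳ (map ι) (map κ) y
          | J.edges-rr x y | J'.edges-rr (map κ x) (map κ y) = map-edge κ x y
  edge-map (left x) (right y)
    rewrite ⊕ᶠ-↑ˡ (map ι) (map κ) x | ⊕ᶠ-↑ʳ (map ι) (map κ) y
          | J.edges-lr x y | J'.edges-lr (map ι x) (map κ y) = cong₂ C (map-label ι x) (map-label κ y)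
  edge-map (right x) (left y)
    rewrite ⊕ᶠ-↑ʳ (map ι) (map κ) x | ⊕ᶠ-↑ˡ (map ι) (map κ) y
          | J.edges-rl y x | J'.edges-rl (map ι y) (map κ x) = cong₂ C (map-label ι y) (map-label κ x)
  label-map : ∀ {x} → Side m n x → J.labels x ≡ J'.labels (f x)
  label-map (left x)
    rewrite ⊕ᶠ-↑ˡ (map ι) (map κ) x | J.labels-l x | J'.labels-l (map ι x) = map-label ι x
  label-map (right y)
    rewrite ⊕ᶠ-↑ʳ (map ι) (map κ) y | J.labels-r y | J'.labels-r (map κ y) = map-label κ y

-- Restriction to a set of vertices

record IsRestriction (G H : LabelledGraph k) (P : Pred (Fin (order H)) 0ℓ) : Set where
  field
    embedding : G ↪ H
    kept      : ∀ x → P (map embedding x)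
    onto      : ∀ y → P y → ∃ λ x → map embedding x ≡ y

open IsRestriction

point-empty : ∀ {P : Pred (Fin 1) 0ℓ} → ¬ P zero → Empty P
point-empty ¬P0 zero = ¬P0

restrict-point : ∀ {a : Fin k} {P} → P zero → IsRestriction (point a) (point a) P
restrict-point P0 = record
  { embedding = ↪-refl
  ; kept      = λ { zero → P0 }
  ; onto      = λ y _ → y , refl
  }

restrict-unary : ∀ {P} Φ Ψ → IsRestriction G H P → IsRestriction (unary Φ Ψ G) (unary Φ Ψ H) P
restrict-unary {G = G} {H = H} Φ Ψ r = record
  { embedding = ↪-reshape ι
      (λ x y → trans (cong (λ A → Φ A _ _) (map-edge ι x y)) (cong₂ (Φ _) (map-label ι x) (map-label ι y)))
      (λ x → cong Ψ (map-label ι x))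
  ; kept = kept r
  ; onto = onto r
  }
  where
  ι : G ↪ H
  ι = embedding r

module _ {C} (J : Join G H C) {P : Pred (Fin (order G + order H)) 0ℓ} where
  private
    m n : ℕ
    m = order G
    n = order H

  empty-join : Empty (P ∘ (_↑ˡ n)) → Empty (P ∘ (m ↑ʳ_)) → Empty P
  empty-join ∅ₗ ∅ᵣ i Pi with side m n i
  ... | left x  = ∅ₗ x Pi
  ... | right y = ∅ᵣ y Pi

  restrict-inl : IsRestriction G' G (P ∘ (_↑ˡ n)) → Empty (P ∘ (m ↑ʳ_)) → IsRestriction G' (graph J) P
  restrict-inl r ∅ᵣ = record
    { embedding = ↪-trans (embedding r) (↪-inl J)
    ; kept      = kept r
    ; onto      = λ i Pi → go (side m n i) Pi
    }
    where
    go : ∀ {i} → Side m n i → P i → ∃ λ x → map (embedding r) x ↑ˡ n ≡ i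
    go (left x)  Px = Product.map₂ (cong (_↑ˡ n)) (onto r x Px)
    go (right y) Py = ⊥-elim (∅ᵣ y Py)

  restrict-inr : Empty (P ∘ (_↑ˡ n)) → IsRestriction H' H (P ∘ (m ↑ʳ_)) → IsRestriction H' (graph J) P
  restrict-inr ∅ₗ r = record
    { embedding = ↪-trans (embedding r) (↪-inr J)
    ; kept      = kept r
    ; onto      = λ i Pi → go (side m n i) Pi
    }
    where
    go : ∀ {i} → Side m n i → P i → ∃ λ y → m ↑ʳ map (embedding r) y ≡ i
    go (left x)  Px = ⊥-elim (∅ₗ x Px)
    go (right y) Py = Product.map₂ (cong (m ↑ʳ_)) (onto r y Py)

  restrict-join : (J' : Join G' H' C) →
                  IsRestriction G' G (P ∘ (_↑ˡ n)) → IsRestriction H' H (P ∘ (m ↑ʳ_)) →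
                  IsRestriction (graph J') (graph J) P
  restrict-join {G' = G'} {H' = H'} J' r s = record
    { embedding = ↪-join J' J (embedding r) (embedding s)
    ; kept      = λ i → kept-side (side (order G') (order H') i)
    ; onto      = λ i Pi → onto-side (side m n i) Pi
    }
    where
    φ : Fin (order G') → Fin m
    φ = map (embedding r)
    ψ : Fin (order H') → Fin n
    ψ = map (embedding s)
    f : Fin (order G' + order H') → Fin (m + n)
    f = φ ⊕ᶠ ψ
    kept-side : ∀ {i} → Side (order G') (order H') i → P (f i)
    kept-side (left x)  = subst P (sym (⊕ᶠ-↑ˡ φ ψ x)) (kept r x)
    kept-side (right y) = subst P (sym (⊕ᶠ-↑ʳ φ ψ y)) (kept s y)
    onto-side : ∀ {i} → Side m n i → P i → ∃ λ j → f j ≡ i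
    onto-side (left x) Px with onto r x Px
    ... | x' , refl = x' ↑ˡ order H' , ⊕ᶠ-↑ˡ φ ψ x'
    onto-side (right y) Py with onto s y Py
    ... | y' , refl = order G' ↑ʳ y' , ⊕ᶠ-↑ʳ φ ψ y'

⟦_⟧ᶜʷ : CWExpr k → LabelledGraph k
⟦ e ⟧ᶜʷ = labelled (cwSize e) (cwAdj e) (cwLab e)

⟦_⟧ⁿˡᶜ : NLCExpr k → LabelledGraph k
⟦ e ⟧ⁿˡᶜ = labelled (nlcSize e) (nlcAdj e) (nlcLab e)

ρ-label : Fin k → Fin k → Fin k → Fin k
ρ-label a b l = if l == a then b else l

link : Bool → Bool → Bool → Bool → Bool → Bool
link A x y z w = A ∨ ((x ∧ y) ∨ (z ∧ w))

η-edge : Fin k → Fin k → Bool → Fin k → Fin k → Bool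
η-edge a b A l l' = link A (l == a) (l' == b) (l == b) (l' == a)

module _ {m n} (l : Fin m → Fin k) (r : Fin n → Fin k) where

  unionLab-↑ˡ : ∀ x → unionLab l r (x ↑ˡ n) ≡ l x
  unionLab-↑ˡ x rewrite splitAt-↑ˡ m x n = refl

  unionLab-↑ʳ : ∀ y → unionLab l r (m ↑ʳ y) ≡ r y
  unionLab-↑ʳ y rewrite splitAt-↑ʳ m n y = refl

module _ {m n} (A : Fin m → Fin m → Bool) (B : Fin n → Fin n → Bool) where

  unionAdj-ll : ∀ x y → unionAdj A B (x ↑ˡ n) (y ↑ˡ n) ≡ A x y
  unionAdj-ll x y rewrite splitAt-↑ˡ m x n | splitAt-↑ˡ m y n = refl

  unionAdj-rr : ∀ x y → unionAdj A B (m ↑ʳ x) (m ↑ʳ y) ≡ B x y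
  unionAdj-rr x y rewrite splitAt-↑ʳ m n x | splitAt-↑ʳ m n y = refl

  unionAdj-lr : ∀ x y → unionAdj A B (x ↑ˡ n) (m ↑ʳ y) ≡ false
  unionAdj-lr x y rewrite splitAt-↑ˡ m x n | splitAt-↑ʳ m n y = refl

  unionAdj-rl : ∀ x y → unionAdj A B (m ↑ʳ y) (x ↑ˡ n) ≡ false
  unionAdj-rl x y rewrite splitAt-↑ʳ m n y | splitAt-↑ˡ m x n = refl

cw-⊕-join : (e f : CWExpr k) → Join ⟦ e ⟧ᶜʷ ⟦ f ⟧ᶜʷ (λ _ _ → false)
cw-⊕-join e f = record
  { edges    = cwAdj (e ⊕ f)
  ; labels   = cwLab (e ⊕ f)
  ; edges-ll = unionAdj-ll (cwAdj e) (cwAdj f)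
  ; edges-rr = unionAdj-rr (cwAdj e) (cwAdj f)
  ; edges-lr = unionAdj-lr (cwAdj e) (cwAdj f)
  ; edges-rl = unionAdj-rl (cwAdj e) (cwAdj f)
  ; labels-l = unionLab-↑ˡ (cwLab e) (cwLab f)
  ; labels-r = unionLab-↑ʳ (cwLab e) (cwLab f)
  }

nlc-join : (S : Fin k → Fin k → Bool) (e f : NLCExpr k) → Join ⟦ e ⟧ⁿˡᶜ ⟦ f ⟧ⁿˡᶜ S
nlc-join S e f = record
  { edges    = nlcAdj (join S e f)
  ; labels   = nlcLab (join S e f)
  ; edges-ll = ll
  ; edges-rr = rr
  ; edges-lr = lr
  ; edges-rl = rl
  ; labels-l = unionLab-↑ˡ (nlcLab e) (nlcLab f)
  ; labels-r = unionLab-↑ʳ (nlcLab e) (nlcLab f)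
  }
  where
  m n : ℕ
  m = nlcSize e
  n = nlcSize f
  ll : ∀ x y → nlcAdj (join S e f) (x ↑ˡ n) (y ↑ˡ n) ≡ nlcAdj e x y
  ll x y rewrite splitAt-↑ˡ m x n | splitAt-↑ˡ m y n = refl
  rr : ∀ x y → nlcAdj (join S e f) (m ↑ʳ x) (m ↑ʳ y) ≡ nlcAdj f x y
  rr x y rewrite splitAt-↑ʳ m n x | splitAt-↑ʳ m n y = refl
  lr : ∀ x y → nlcAdj (join S e f) (x ↑ˡ n) (m ↑ʳ y) ≡ S (nlcLab e x) (nlcLab f y)
  lr x y rewrite splitAt-↑ˡ m x n | splitAt-↑ʳ m n y = refl
  rl : ∀ x y → nlcAdj (join S e f) (m ↑ʳ y) (x ↑ˡ n) ≡ S (nlcLab e x) (nlcLab f y)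
  rl x y rewrite splitAt-↑ʳ m n y | splitAt-↑ˡ m x n = refl

cw-vertex : (e : CWExpr k) → Fin (cwSize e)
cw-vertex (vtx _)     = zero
cw-vertex (e ⊕ _)     = cw-vertex e ↑ˡ _
cw-vertex (ρ _ _ _ e) = cw-vertex e
cw-vertex (η _ _ _ e) = cw-vertex e

nlc-vertex : (e : NLCExpr k) → Fin (nlcSize e)
nlc-vertex (vtx _)      = zero
nlc-vertex (join _ e _) = nlc-vertex e ↑ˡ _
nlc-vertex (relab _ e)  = nlc-vertex e

restrictCW : (e : CWExpr k) {P : Pred (Fin (cwSize e)) 0ℓ} → Decidable P →
             Empty P ⊎ ∃ λ e' → IsRestriction ⟦ e' ⟧ᶜʷ ⟦ e ⟧ᶜʷ P
restrictCW (vtx a) P? with P? zero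
... | yes P0 = inj₂ (vtx a , restrict-point P0)
... | no ¬P0 = inj₁ (point-empty ¬P0)
restrictCW (ρ a b a≢b e) P? =
  Sum.map₂ (Product.map (ρ a b a≢b) (restrict-unary (λ A _ _ → A) (ρ-label a b))) (restrictCW e P?)
restrictCW (η a b a≢b e) P? =
  Sum.map₂ (Product.map (η a b a≢b) (restrict-unary (η-edge a b) (λ l → l))) (restrictCW e P?)
restrictCW (e ⊕ f) P? with restrictCW e (P? ∘ (_↑ˡ cwSize f)) | restrictCW f (P? ∘ (cwSize e ↑ʳ_))
... | inj₁ ∅ₗ       | inj₁ ∅ᵣ       = inj₁ (empty-join (cw-⊕-join e f) ∅ₗ ∅ᵣ)
... | inj₂ (e' , r) | inj₁ ∅ᵣ       = inj₂ (e' , restrict-inl (cw-⊕-join e f) r ∅ᵣ)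
... | inj₁ ∅ₗ       | inj₂ (f' , s) = inj₂ (f' , restrict-inr (cw-⊕-join e f) ∅ₗ s)
... | inj₂ (e' , r) | inj₂ (f' , s) = inj₂ (e' ⊕ f' , restrict-join (cw-⊕-join e f) (cw-⊕-join e' f') r s)

restrictNLC : (e : NLCExpr k) {P : Pred (Fin (nlcSize e)) 0ℓ} → Decidable P →
              Empty P ⊎ ∃ λ e' → IsRestriction ⟦ e' ⟧ⁿˡᶜ ⟦ e ⟧ⁿˡᶜ P
restrictNLC (vtx a) P? with P? zero
... | yes P0 = inj₂ (vtx a , restrict-point P0)
... | no ¬P0 = inj₁ (point-empty ¬P0)
restrictNLC (relab R e) P? =
  Sum.map₂ (Product.map (relab R) (restrict-unary (λ A _ _ → A) R)) (restrictNLC e P?)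
restrictNLC (join S e f) P? with restrictNLC e (P? ∘ (_↑ˡ nlcSize f)) | restrictNLC f (P? ∘ (nlcSize e ↑ʳ_))
... | inj₁ ∅ₗ       | inj₁ ∅ᵣ       = inj₁ (empty-join (nlc-join S e f) ∅ₗ ∅ᵣ)
... | inj₂ (e' , r) | inj₁ ∅ᵣ       = inj₂ (e' , restrict-inl (nlc-join S e f) r ∅ᵣ)
... | inj₁ ∅ₗ       | inj₂ (f' , s) = inj₂ (f' , restrict-inr (nlc-join S e f) ∅ₗ s)
... | inj₂ (e' , r) | inj₂ (f' , s) =
  inj₂ (join S e' f' , restrict-join (nlc-join S e f) (nlc-join S e' f') r s)

record _⊑_ (G : Graph) {m} (B : Fin m → Fin m → Bool) : Set where
  field
    pos           : Fin (size G) → Fin m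
    pos-injective : Injective _≡_ _≡_ pos
    pos-adj       : ∀ i j → adj G i j ≡ B (pos i) (pos j)

open _⊑_

iso⇒⊑ : ∀ {G m B} → IsoTo G m B → G ⊑ B
iso⇒⊑ iso = record
  { pos           = Bijection.to bij
  ; pos-injective = Bijection.injective bij
  ; pos-adj       = pres
  }
  where open IsoTo iso

⊑-↪ : ∀ {G} → G ⊑ edge H → H ↪ H' → G ⊑ edge H'
⊑-↪ ι κ = record
  { pos           = map κ ∘ pos ι
  ; pos-injective = pos-injective ι ∘ map-injective κ
  ; pos-adj       = λ i j → trans (pos-adj ι i j) (map-edge κ (pos ι i) (pos ι j))
  }

⊑-addVertex⁻ : ∀ {G N m} {B : Fin m → Fin m → Bool} → addVertex G N ⊑ B → G ⊑ B
⊑-addVertex⁻ ι = record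
  { pos           = pos ι ∘ suc
  ; pos-injective = suc-injective ∘ pos-injective ι
  ; pos-adj       = λ i j → pos-adj ι (suc i) (suc j)
  }

image? : ∀ {n m} (f : Fin n → Fin m) → Decidable (λ y → ∃ λ i → f i ≡ y)
image? f y = any? λ i → f i ≟ y

restriction⇒iso : ∀ {G} (ι : G ⊑ edge H) → IsRestriction H' H (λ y → ∃ λ i → pos ι i ≡ y) →
                  IsoTo G (order H') (edge H')
restriction⇒iso {H = H} {H' = H'} {G = G} ι r = record
  { bij  = mk⤖ {to = to} (to-injective , to-surjective)
  ; pres = to-adj
  }
  where
  ε : H' ↪ H
  ε = embedding r
  to : Fin (size G) → Fin (order H')
  to i = proj₁ (onto r (pos ι i) (i , refl))
  map-to : ∀ i → map ε (to i) ≡ pos ι i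
  map-to i = proj₂ (onto r (pos ι i) (i , refl))
  to-injective : Injective _≡_ _≡_ to
  to-injective {i} {j} eq = pos-injective ι (trans (sym (map-to i)) (trans (cong (map ε) eq) (map-to j)))
  to-surjective : ∀ z → ∃ λ i → ∀ {j} → j ≡ i → to j ≡ z
  to-surjective z with kept r z
  ... | i , pos-i = i , λ { refl → map-injective ε (trans (map-to i) pos-i) }
  to-adj : ∀ i j → adj G i j ≡ edge H' (to i) (to j)
  to-adj i j = begin
    adj G i j                             ≡⟨ pos-adj ι i j ⟩
    edge H (pos ι i) (pos ι j)            ≡⟨ cong₂ (edge H) (map-to i) (map-to j) ⟨
    edge H (map ε (to i)) (map ε (to j))  ≡⟨ map-edge ε (to i) (to j) ⟨
    edge H' (to i) (to j)                 ∎
    where open ≡-Reasoning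

⊑⇒InCW : ∀ {G} (e : CWExpr k) → G ⊑ cwAdj e → Fin (size G) → InCW G k
⊑⇒InCW e ι v with restrictCW e (image? (pos ι))
... | inj₁ ∅        = ⊥-elim (∅ (pos ι v) (v , refl))
... | inj₂ (e' , r) = e' , restriction⇒iso ι r

⊑⇒InNLC : ∀ {G} (e : NLCExpr k) → G ⊑ nlcAdj e → Fin (size G) → InNLC G k
⊑⇒InNLC e ι v with restrictNLC e (image? (pos ι))
... | inj₁ ∅        = ⊥-elim (∅ (pos ι v) (v , refl))
... | inj₂ (e' , r) = e' , restriction⇒iso ι r

InCW-vertex : ∀ {G} → InCW G k → Fin (size G)
InCW-vertex (e , iso) = Inverse.from (⤖⇒↔ (IsoTo.bij iso)) (cw-vertex e)

InNLC-vertex : ∀ {G} → InNLC G k → Fin (size G)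
InNLC-vertex (e , iso) = Inverse.from (⤖⇒↔ (IsoTo.bij iso)) (nlc-vertex e)

InCW-addVertex⁻ : ∀ {G N} → InCW (addVertex G N) k → Fin (size G) → InCW G k
InCW-addVertex⁻ (e , iso) = ⊑⇒InCW e (⊑-addVertex⁻ (iso⇒⊑ iso))

InNLC-addVertex⁻ : ∀ {G N} → InNLC (addVertex G N) k → Fin (size G) → InNLC G k
InNLC-addVertex⁻ (e , iso) = ⊑⇒InNLC e (⊑-addVertex⁻ (iso⇒⊑ iso))

-- Signed labels

==-refl : (a : Fin k) → (a == a) ≡ true
==-refl a = dec-true (a ≟ a) refl

==-false : {a b : Fin k} → a ≢ b → (a == b) ≡ false
==-false {a = a} {b} = dec-false (a ≟ b)

-- Opaque, so that unification treats tag as rigid instead of unfolding combine, which it cannot invert.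
opaque
  bit : Bool → Fin 2
  bit false = zero
  bit true  = suc zero

  tag : Bool → Fin k → Fin (2 * k)
  tag s = combine (bit s)

  sign : Fin (2 * k) → Bool
  sign {k} l = proj₁ (remQuot {2} k l) == suc zero

  untag : Fin (2 * k) → Fin k
  untag {k} l = proj₂ (remQuot {2} k l)

  sign-tag : ∀ s (a : Fin k) → sign {k} (tag s a) ≡ s
  sign-tag s a = trans (cong ((_== suc zero) ∘ proj₁) (remQuot-combine (bit s) a)) (bit-sign s)
    where
    bit-sign : ∀ s → (bit s == suc zero) ≡ s
    bit-sign false = refl
    bit-sign true  = refl

  untag-tag : ∀ s (a : Fin k) → untag {k} (tag s a) ≡ a
  untag-tag s a = cong proj₂ (remQuot-combine (bit s) a)

  bit-injective : ∀ {s t} → bit s ≡ bit t → s ≡ t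
  bit-injective {false} {false} _ = refl
  bit-injective {true}  {true}  _ = refl

  tag-injective : ∀ {s t} {a b : Fin k} → tag s a ≡ tag t b → s ≡ t × a ≡ b
  tag-injective {s = s} {t} {a} {b} eq with combine-injective (bit s) a (bit t) b eq
  ... | bit-s≡bit-t , a≡b = bit-injective bit-s≡bit-t , a≡b

tag-injectiveʳ : ∀ s → Injective _≡_ _≡_ (tag {k} s)
tag-injectiveʳ s = proj₂ ∘ tag-injective {s = s} {s}

tag-≢ : ∀ s t {a b : Fin k} → a ≢ b → tag s a ≢ tag t b
tag-≢ s t a≢b = a≢b ∘ proj₂ ∘ tag-injective {s = s} {t}

tag-sign-≢ : ∀ {s t} {a b : Fin k} → s ≢ t → tag s a ≢ tag t b
tag-sign-≢ {s = s} {t} s≢t = s≢t ∘ proj₁ ∘ tag-injective {s = s} {t}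

tag-== : ∀ p s (l a : Fin k) → (tag {k} p l == tag s a) ≡ (does (p Bool.≟ s) ∧ (l == a))
tag-== {k} p s l a with p Bool.≟ s | l ≟ a
... | yes refl | yes refl = ==-refl (tag {k} p l)
... | yes refl | no l≢a   = ==-false (l≢a ∘ proj₂ ∘ tag-injective {s = p} {p})
... | no p≢s   | _        = ==-false (p≢s ∘ proj₁ ∘ tag-injective)

tag-==-true : ∀ p (a : Fin k) → (tag p a == tag true a) ≡ p
tag-==-true false a = tag-== false true a a
tag-==-true true  a = trans (tag-== true true a a) (==-refl a)

signed : (G : LabelledGraph k) → (Fin (order G) → Bool) → LabelledGraph (2 * k)
signed G P = labelled (order G) (edge G) (λ x → tag (P x) (label G x))

signed-join : ∀ {C} (J : Join G H C) (P : Fin (order G + order H) → Bool) →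
              Join (signed G (P ∘ (_↑ˡ order H))) (signed H (P ∘ (order G ↑ʳ_)))
                   (λ l l' → C (untag {k} l) (untag {k} l'))
signed-join {k = k} {G = G} {H} {C} J P = record
  { edges    = edges
  ; labels   = λ x → tag (P x) (labels x)
  ; edges-ll = edges-ll
  ; edges-rr = edges-rr
  ; edges-lr = λ x y → trans (edges-lr x y) (sym (untag-both x y))
  ; edges-rl = λ x y → trans (edges-rl x y) (sym (untag-both x y))
  ; labels-l = λ x → cong (tag (P (x ↑ˡ order H))) (labels-l x)
  ; labels-r = λ y → cong (tag (P (order G ↑ʳ y))) (labels-r y)
  }
  where
  open Join J
  untag-both : ∀ x y → C (untag {k} (tag (P (x ↑ˡ order H)) (label G x)))
                         (untag {k} (tag (P (order G ↑ʳ y)) (label H y)))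
                       ≡ C (label G x) (label H y)
  untag-both x y = cong₂ C (untag-tag (P (x ↑ˡ order H)) (label G x)) (untag-tag (P (order G ↑ʳ y)) (label H y))

-- Doubling an NLC-expression

relab± : (Fin k → Fin k) → Fin (2 * k) → Fin (2 * k)
relab± {k} R l = tag (sign {k} l) (R (untag {k} l))

doubleNLC : (e : NLCExpr k) → (Fin (nlcSize e) → Bool) → NLCExpr (2 * k)
doubleNLC     (vtx a)      P = vtx (tag (P zero) a)
doubleNLC {k} (join S e f) P = join (λ l l' → S (untag {k} l) (untag {k} l'))
                                    (doubleNLC e (P ∘ (_↑ˡ nlcSize f))) (doubleNLC f (P ∘ (nlcSize e ↑ʳ_)))
doubleNLC     (relab R e)  P = relab (relab± R) (doubleNLC e P)

doubleNLC-↪ : (e : NLCExpr k) (P : Fin (nlcSize e) → Bool) → signed ⟦ e ⟧ⁿˡᶜ P ↪ ⟦ doubleNLC e P ⟧ⁿˡᶜ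
doubleNLC-↪ (vtx a) P = ↪-reshape (↪-refl {G = point (tag (P zero) a)}) (λ _ _ → refl) (λ { zero → refl })
doubleNLC-↪ (join S e f) P =
  ↪-join (signed-join (nlc-join S e f) P) (nlc-join _ (doubleNLC e Pₗ) (doubleNLC f Pᵣ))
         (doubleNLC-↪ e Pₗ) (doubleNLC-↪ f Pᵣ)
  where
  Pₗ : Fin (nlcSize e) → Bool
  Pₗ = P ∘ (_↑ˡ nlcSize f)
  Pᵣ : Fin (nlcSize f) → Bool
  Pᵣ = P ∘ (nlcSize e ↑ʳ_)
doubleNLC-↪ {k} (relab R e) P = ↪-reshape ι (map-edge ι) label-map
  where
  ι = doubleNLC-↪ e P
  label-map : ∀ x → tag (P x) (R (nlcLab e x)) ≡ relab± R (nlcLab (doubleNLC e P) (map ι x))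
  label-map x rewrite sym (map-label ι x) | sign-tag {k} (P x) (nlcLab e x) | untag-tag {k} (P x) (nlcLab e x) =
    refl

-- Doubling a CW-expression

ρ-label-self : (a b : Fin k) → ρ-label a b a ≡ b
ρ-label-self a b = cong (λ c → if c then b else a) (==-refl a)

ρ-label-≢ : ∀ {a b l : Fin k} → l ≢ a → ρ-label a b l ≡ l
ρ-label-≢ {b = b} {l} l≢a = cong (λ c → if c then b else l) (==-false l≢a)

ρ-label-map : ∀ {k'} {f : Fin k → Fin k'} → Injective _≡_ _≡_ f →
              ∀ a b l → ρ-label (f a) (f b) (f l) ≡ f (ρ-label a b l)
ρ-label-map {f = f} f-inj a b l with l ≟ a
... | yes refl = ρ-label-self (f l) (f b)
... | no l≢a   = ρ-label-≢ (l≢a ∘ f-inj)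

ρ± : (a b : Fin k) → a ≢ b → CWExpr (2 * k) → CWExpr (2 * k)
ρ± a b a≢b = ρ (tag false a) (tag false b) (tag-≢ false false a≢b) ∘ ρ (tag true a) (tag true b) (tag-≢ true true a≢b)

ρ±-label : ∀ p (a b l : Fin k) →
           ρ-label (tag false a) (tag false b) (ρ-label (tag true a) (tag true b) (tag p l)) ≡ tag p (ρ-label a b l)
ρ±-label true a b l = begin
  ρ-label (tag false a) (tag false b) (ρ-label (tag true a) (tag true b) (tag true l))
    ≡⟨ cong (ρ-label (tag false a) (tag false b)) (ρ-label-map (tag-injectiveʳ true) a b l) ⟩
  ρ-label (tag false a) (tag false b) (tag true (ρ-label a b l))
    ≡⟨ ρ-label-≢ (tag-sign-≢ λ ()) ⟩
  tag true (ρ-label a b l) ∎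
  where open ≡-Reasoning
ρ±-label false a b l = begin
  ρ-label (tag false a) (tag false b) (ρ-label (tag true a) (tag true b) (tag false l))
    ≡⟨ cong (ρ-label (tag false a) (tag false b)) (ρ-label-≢ (tag-sign-≢ λ ())) ⟩
  ρ-label (tag false a) (tag false b) (tag false l)
    ≡⟨ ρ-label-map (tag-injectiveʳ false) a b l ⟩
  tag false (ρ-label a b l) ∎
  where open ≡-Reasoning

η± : (a b : Fin k) → a ≢ b → CWExpr (2 * k) → CWExpr (2 * k)
η± a b a≢b = η (tag false a) (tag false b) (tag-≢ false false a≢b) ∘ η (tag false a) (tag true b) (tag-≢ false true a≢b)
           ∘ η (tag true a) (tag false b) (tag-≢ true false a≢b) ∘ η (tag true a) (tag true b) (tag-≢ true true a≢b)

η±-edge : Fin k → Fin k → Bool → Fin (2 * k) → Fin (2 * k) → Bool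
η±-edge a b A l l' =
  η-edge (tag false a) (tag false b) (η-edge (tag false a) (tag true b)
    (η-edge (tag true a) (tag false b) (η-edge (tag true a) (tag true b) A l l') l l') l l') l l'

signedLink : (p q s t : Bool) → Bool → Bool → Bool → Bool → Bool → Bool
signedLink p q s t A x y z w =
  link A (does (p Bool.≟ s) ∧ x) (does (q Bool.≟ t) ∧ y) (does (p Bool.≟ t) ∧ z) (does (q Bool.≟ s) ∧ w)

η-edge-tag : ∀ p q s t A (a b l l' : Fin k) →
             η-edge (tag s a) (tag t b) A (tag p l) (tag q l') ≡ signedLink p q s t A (l == a) (l' == b) (l == b) (l' == a)
η-edge-tag p q s t A a b l l' =
  cong₂ (λ u v → A ∨ (u ∨ v)) (cong₂ _∧_ (tag-== p s l a) (tag-== q t l' b)) (cong₂ _∧_ (tag-== p t l b) (tag-== q s l' a))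

module _ where
  open ∨-∧-Solver

  private
    chain : Bool → Bool → (A x y z w : Polynomial 5) → Polynomial 5
    chain p q A x y z w = step false false (step false true (step true false (step true true A)))
      where
      same : Bool → Bool → Polynomial 5
      same u v = con (does (u Bool.≟ v))
      step : Bool → Bool → Polynomial 5 → Polynomial 5
      step s t B = B :+ (((same p s :* x) :* (same q t :* y)) :+ ((same p t :* z) :* (same q s :* w)))

  signedLink-all : ∀ p q A x y z w →
    signedLink p q false false (signedLink p q false true (signedLink p q true false
      (signedLink p q true true A x y z w) x y z w) x y z w) x y z w
    ≡ link A x y z w
  signedLink-all false false = solve 5 (λ A x y z w → chain false false A x y z w := A :+ ((x :* y) :+ (z :* w))) refl
  signedLink-all false true  = solve 5 (λ A x y z w → chain false true  A x y z w := A :+ ((x :* y) :+ (z :* w))) refl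
  signedLink-all true  false = solve 5 (λ A x y z w → chain true  false A x y z w := A :+ ((x :* y) :+ (z :* w))) refl
  signedLink-all true  true  = solve 5 (λ A x y z w → chain true  true  A x y z w := A :+ ((x :* y) :+ (z :* w))) refl

-- For fixed signs p and q of the endpoints, only the joins between the classes of sign p and q can fire.
η±-edge-tag : ∀ p q A (a b l l' : Fin k) → η±-edge a b A (tag p l) (tag q l') ≡ η-edge a b A l l'
η±-edge-tag p q A a b l l' = begin
  η±-edge a b A (tag p l) (tag q l')
    ≡⟨ step false false (step false true (step true false (step true true (refl {x = A})))) ⟩
  signedLink p q false false (signedLink p q false true (signedLink p q true false
    (signedLink p q true true A x y z w) x y z w) x y z w) x y z w
    ≡⟨ signedLink-all p q A x y z w ⟩
  η-edge a b A l l' ∎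
  where
  open ≡-Reasoning
  x y z w : Bool
  x = l == a
  y = l' == b
  z = l == b
  w = l' == a
  step : ∀ s t {B C} → B ≡ C → η-edge (tag s a) (tag t b) B (tag p l) (tag q l') ≡ signedLink p q s t C x y z w
  step s t {B} refl = η-edge-tag p q s t B a b l l'

module _ {G : LabelledGraph k} {P : Fin (order G) → Bool} (D : CWExpr (2 * k)) (ι : signed G P ↪ ⟦ D ⟧ᶜʷ) where

  ρ±-↪ : ∀ a b a≢b → signed (unary (λ A _ _ → A) (ρ-label a b) G) P ↪ ⟦ ρ± a b a≢b D ⟧ᶜʷ
  ρ±-↪ a b a≢b = ↪-reshape ι (map-edge ι) label-map
    where
    label-map : ∀ x → tag (P x) (ρ-label a b (label G x))
                      ≡ ρ-label (tag false a) (tag false b) (ρ-label (tag true a) (tag true b) (cwLab D (map ι x)))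
    label-map x rewrite sym (map-label ι x) = sym (ρ±-label (P x) a b (label G x))

  η±-↪ : ∀ a b a≢b → signed (unary (η-edge a b) (λ l → l) G) P ↪ ⟦ η± a b a≢b D ⟧ᶜʷ
  η±-↪ a b a≢b = ↪-reshape ι edge-map (map-label ι)
    where
    edge-map : ∀ x y → η-edge a b (edge G x y) (label G x) (label G y)
                       ≡ η±-edge a b (cwAdj D (map ι x) (map ι y)) (cwLab D (map ι x)) (cwLab D (map ι y))
    edge-map x y rewrite sym (map-edge ι x y) | sym (map-label ι x) | sym (map-label ι y) =
      sym (η±-edge-tag (P x) (P y) (edge G x y) a b (label G x) (label G y))

doubleCW : (e : CWExpr k) → (Fin (cwSize e) → Bool) → CWExpr (2 * k)
doubleCW (vtx a)       P = vtx (tag (P zero) a)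
doubleCW (e ⊕ f)       P = doubleCW e (P ∘ (_↑ˡ cwSize f)) ⊕ doubleCW f (P ∘ (cwSize e ↑ʳ_))
doubleCW (ρ a b a≢b e) P = ρ± a b a≢b (doubleCW e P)
doubleCW (η a b a≢b e) P = η± a b a≢b (doubleCW e P)

doubleCW-↪ : (e : CWExpr k) (P : Fin (cwSize e) → Bool) → signed ⟦ e ⟧ᶜʷ P ↪ ⟦ doubleCW e P ⟧ᶜʷ
doubleCW-↪ (vtx a) P = ↪-reshape (↪-refl {G = point (tag (P zero) a)}) (λ _ _ → refl) (λ { zero → refl })
doubleCW-↪ (e ⊕ f) P =
  ↪-join (signed-join (cw-⊕-join e f) P) (cw-⊕-join (doubleCW e Pₗ) (doubleCW f Pᵣ))
         (doubleCW-↪ e Pₗ) (doubleCW-↪ f Pᵣ)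
  where
  Pₗ : Fin (cwSize e) → Bool
  Pₗ = P ∘ (_↑ˡ cwSize f)
  Pᵣ : Fin (cwSize f) → Bool
  Pᵣ = P ∘ (cwSize e ↑ʳ_)
doubleCW-↪ (ρ a b a≢b e) P = ρ±-↪ (doubleCW e P) (doubleCW-↪ e P) a b a≢b
doubleCW-↪ (η a b a≢b e) P = η±-↪ (doubleCW e P) (doubleCW-↪ e P) a b a≢b

-- Adding a vertex

record ApexEmbedding (G : Graph) (N : Fin (size G) → Bool) {m} (B : Fin m → Fin m → Bool) : Set where
  field
    old           : Fin (size G) → Fin m
    apex          : Fin m
    old-injective : Injective _≡_ _≡_ old
    old≢apex      : ∀ i → old i ≢ apex
    old-old       : ∀ i j → B (old i) (old j) ≡ adj G i j
    old-apex      : ∀ i → B (old i) apex ≡ N i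
    apex-old      : ∀ i → B apex (old i) ≡ N i
    apex-apex     : B apex apex ≡ false

apex⇒⊑ : ∀ {G N m} {B : Fin m → Fin m → Bool} → ApexEmbedding G N B → addVertex G N ⊑ B
apex⇒⊑ {G = G} {N} {B = B} A = record
  { pos           = pos'
  ; pos-injective = injective
  ; pos-adj       = adjacent
  }
  where
  open ApexEmbedding A
  pos' : Fin (suc (size G)) → _
  pos' zero    = apex
  pos' (suc i) = old i
  injective : Injective _≡_ _≡_ pos'
  injective {zero}  {zero}  _  = refl
  injective {zero}  {suc j} eq = ⊥-elim (old≢apex j (sym eq))
  injective {suc i} {zero}  eq = ⊥-elim (old≢apex i eq)
  injective {suc i} {suc j} eq = cong suc (old-injective eq)
  adjacent : ∀ i j → adj (addVertex G N) i j ≡ B (pos' i) (pos' j)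
  adjacent zero    zero    = sym apex-apex
  adjacent zero    (suc j) = sym (apex-old j)
  adjacent (suc i) zero    = sym (old-apex i)
  adjacent (suc i) (suc j) = sym (old-old i j)

module NLCExtension {G : Graph} (N : Fin (size G) → Bool) (e : NLCExpr k) (iso : IsoTo G (nlcSize e) (nlcAdj e)) where
  open Inverse (⤖⇒↔ (IsoTo.bij iso)) using (to; from; strictlyInverseʳ)

  P : Fin (nlcSize e) → Bool
  P = N ∘ from

  D : NLCExpr (2 * k)
  D = doubleNLC e P

  δ : signed ⟦ e ⟧ⁿˡᶜ P ↪ ⟦ D ⟧ⁿˡᶜ
  δ = doubleNLC-↪ e P

  ι : G ⊑ nlcAdj D
  ι = ⊑-↪ (iso⇒⊑ iso) δ

  by-sign : Fin (2 * k) → Fin (2 * k) → Bool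
  by-sign l _ = sign {k} l

  K : NLCExpr (2 * k)
  K = join by-sign D (vtx (tag false (nlcLab e (nlc-vertex e))))

  open Join (nlc-join by-sign D (vtx (tag false (nlcLab e (nlc-vertex e)))))

  sign-old : ∀ i → sign {k} (nlcLab D (pos ι i)) ≡ N i
  sign-old i = begin
    sign (nlcLab D (map δ (to i)))           ≡⟨ cong sign (map-label δ (to i)) ⟨
    sign (tag (P (to i)) (nlcLab e (to i)))  ≡⟨ sign-tag (P (to i)) _ ⟩
    N (from (to i))                          ≡⟨ cong N (strictlyInverseʳ i) ⟩
    N i                                      ∎
    where open ≡-Reasoning

  extension : ApexEmbedding G N (nlcAdj K)
  extension = record
    { old           = λ i → pos ι i ↑ˡ 1
    ; apex          = nlcSize D ↑ʳ zero
    ; old-injective = pos-injective ι ∘ ↑ˡ-injective 1 _ _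
    ; old≢apex      = λ i → ↑ˡ≢↑ʳ (pos ι i) zero
    ; old-old       = λ i j → trans (edges-ll (pos ι i) (pos ι j)) (sym (pos-adj ι i j))
    ; old-apex      = λ i → trans (edges-lr (pos ι i) zero) (sign-old i)
    ; apex-old      = λ i → trans (edges-rl (pos ι i) zero) (sign-old i)
    ; apex-apex     = edges-rr zero zero
    }

InNLC-addVertex⁺ : ∀ {G} N → InNLC G k → InNLC (addVertex G N) (2 * k)
InNLC-addVertex⁺ N (e , iso) = ⊑⇒InNLC K (apex⇒⊑ extension) zero
  where open NLCExtension N e iso

module _ {a b : Fin k} where

  η-edge-away : ∀ A {l l'} → l ≢ b → l' ≢ b → η-edge a b A l l' ≡ A
  η-edge-away A {l} l≢b l'≢b rewrite ==-false l≢b | ==-false l'≢b | ∧-zeroʳ (l == a) = ∨-identityʳ A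

  η-edge-into : ∀ {l} → l ≢ b → η-edge a b false l b ≡ (l == a)
  η-edge-into {l} l≢b rewrite ==-refl b | ==-false l≢b | ∧-identityʳ (l == a) = ∨-identityʳ (l == a)

  η-edge-from : b ≢ a → ∀ l → η-edge a b false b l ≡ (l == a)
  η-edge-from b≢a l rewrite ==-false b≢a | ==-refl b = refl

  η-edge-self : b ≢ a → η-edge a b false b b ≡ false
  η-edge-self b≢a rewrite ==-false b≢a | ==-refl b = refl

collapse : List (Fin k) → CWExpr (2 * suc k) → CWExpr (2 * suc k)
collapse []       D = D
collapse (i ∷ is) D = collapse is (ρ± (suc i) zero (λ ()) D)

merge : List (Fin k) → Fin (suc k) → Fin (suc k)
merge []       a = a
merge (i ∷ is) a = merge is (ρ-label (suc i) zero a)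

collapse-↪ : ∀ {G : LabelledGraph (suc k)} {P} is {D} → signed G P ↪ ⟦ D ⟧ᶜʷ →
             signed (unary (λ A _ _ → A) (merge is) G) P ↪ ⟦ collapse is D ⟧ᶜʷ
collapse-↪ []           ι = ι
collapse-↪ (i ∷ is) {D} ι = collapse-↪ is (ρ±-↪ D ι (suc i) zero (λ ()))

merge-zero : ∀ (is : List (Fin k)) → merge is zero ≡ zero
merge-zero []       = refl
merge-zero (i ∷ is) = merge-zero is

merge-∈ : ∀ {j} {is : List (Fin k)} → j ∈ is → merge is (suc j) ≡ zero
merge-∈ {j = j} {is = _ ∷ is} (here refl) = trans (cong (merge is) (ρ-label-self (suc j) zero)) (merge-zero is)
merge-∈ {j = j} {is = i ∷ is} (there j∈is) with j ≟ i
... | yes refl = merge-zero is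
... | no _     = merge-∈ j∈is

merge-allFin : ∀ a → merge (allFin k) a ≡ zero
merge-allFin zero    = merge-zero (allFin _)
merge-allFin (suc j) = merge-∈ (∈-allFin j)

-- After collapsing, only the labels (s, 0) are in use, so (false, 1) is free for the new vertex.
module CWExtension {k : ℕ} {G : Graph} (N : Fin (size G) → Bool)
                   (e : CWExpr (suc (suc k))) (iso : IsoTo G (cwSize e) (cwAdj e)) where
  open Inverse (⤖⇒↔ (IsoTo.bij iso)) using (to; from; strictlyInverseʳ)

  P : Fin (cwSize e) → Bool
  P = N ∘ from

  D : CWExpr (2 * suc (suc k))
  D = collapse (allFin (suc k)) (doubleCW e P)

  δ : signed (unary (λ A _ _ → A) (merge (allFin (suc k))) ⟦ e ⟧ᶜʷ) P ↪ ⟦ D ⟧ᶜʷ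
  δ = collapse-↪ (allFin (suc k)) (doubleCW-↪ e P)

  ι : G ⊑ cwAdj D
  ι = ⊑-↪ (iso⇒⊑ iso) δ

  first second : Fin (suc (suc k))
  first  = zero
  second = suc zero

  c c⁺ : Fin (2 * suc (suc k))
  c  = tag false second
  c⁺ = tag true first

  c≢c⁺ : c ≢ c⁺
  c≢c⁺ = tag-sign-≢ {s = false} {true} λ ()

  U K : CWExpr (2 * suc (suc k))
  U = D ⊕ vtx c
  K = η c⁺ c (c≢c⁺ ∘ sym) U

  open Join (cw-⊕-join D (vtx c))

  old : Fin (size G) → Fin (cwSize U)
  old i = pos ι i ↑ˡ 1

  apex : Fin (cwSize U)
  apex = cwSize D ↑ʳ zero

  label-old : ∀ i → cwLab U (old i) ≡ tag (N i) first
  label-old i = begin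
    cwLab U (old i)                                                  ≡⟨ labels-l (pos ι i) ⟩
    cwLab D (map δ (to i))                                           ≡⟨ map-label δ (to i) ⟨
    tag (N (from (to i))) (merge (allFin (suc k)) (cwLab e (to i)))
      ≡⟨ cong₂ tag (cong N (strictlyInverseʳ i)) (merge-allFin (cwLab e (to i))) ⟩
    tag (N i) first                                                  ∎
    where open ≡-Reasoning

  label-old≢c : ∀ i → cwLab U (old i) ≢ c
  label-old≢c i rewrite label-old i = tag-≢ (N i) false λ ()

  old-is-c⁺ : ∀ i → (cwLab U (old i) == c⁺) ≡ N i
  old-is-c⁺ i rewrite label-old i = tag-==-true (N i) first

  old-old : ∀ i j → cwAdj K (old i) (old j) ≡ adj G i j
  old-old i j = begin
    cwAdj K (old i) (old j)      ≡⟨ η-edge-away _ (label-old≢c i) (label-old≢c j) ⟩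
    cwAdj U (old i) (old j)      ≡⟨ edges-ll (pos ι i) (pos ι j) ⟩
    cwAdj D (pos ι i) (pos ι j)  ≡⟨ pos-adj ι i j ⟨
    adj G i j                    ∎
    where open ≡-Reasoning

  old-apex : ∀ i → cwAdj K (old i) apex ≡ N i
  old-apex i rewrite edges-lr (pos ι i) zero | labels-r zero = trans (η-edge-into (label-old≢c i)) (old-is-c⁺ i)

  apex-old : ∀ i → cwAdj K apex (old i) ≡ N i
  apex-old i rewrite edges-rl (pos ι i) zero | labels-r zero =
    trans (η-edge-from c≢c⁺ (cwLab U (old i))) (old-is-c⁺ i)

  apex-apex : cwAdj K apex apex ≡ false
  apex-apex rewrite edges-rr zero zero | labels-r zero = η-edge-self c≢c⁺

  extension : ApexEmbedding G N (cwAdj K)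
  extension = record
    { old           = old
    ; apex          = apex
    ; old-injective = pos-injective ι ∘ ↑ˡ-injective 1 _ _
    ; old≢apex      = λ i → ↑ˡ≢↑ʳ (pos ι i) zero
    ; old-old       = old-old
    ; old-apex      = old-apex
    ; apex-old      = apex-old
    ; apex-apex     = apex-apex
    }

cw₁-edgeless : (e : CWExpr 1) → ∀ x y → cwAdj e x y ≡ false
cw₁-edgeless (vtx _) x y = refl
cw₁-edgeless (ρ zero zero a≢b e) = ⊥-elim (a≢b refl)
cw₁-edgeless (η zero zero a≢b e) = ⊥-elim (a≢b refl)
cw₁-edgeless (e ⊕ f) x y = go (side (cwSize e) (cwSize f) x) (side (cwSize e) (cwSize f) y)
  where
  open Join (cw-⊕-join e f)
  go : ∀ {x y} → Side (cwSize e) (cwSize f) x → Side (cwSize e) (cwSize f) y → cwAdj (e ⊕ f) x y ≡ false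
  go (left x)  (left y)  = trans (edges-ll x y) (cw₁-edgeless e x y)
  go (right x) (right y) = trans (edges-rr x y) (cw₁-edgeless f x y)
  go (left x)  (right y) = edges-lr x y
  go (right x) (left y)  = edges-rl y x

-- With one label G is edgeless, so H embeds into S ⊕ D, where S joins the new vertex to a copy of D:
-- the neighbours of the new vertex are taken from S, the other vertices from the second copy of D.
module CW₁Extension {G : Graph} (N : Fin (size G) → Bool) (e : CWExpr 1) (iso : IsoTo G (cwSize e) (cwAdj e)) where
  open Inverse (⤖⇒↔ (IsoTo.bij iso)) using (to)

  D : CWExpr 2
  D = doubleCW e (λ _ → true)

  δ : signed ⟦ e ⟧ᶜʷ (λ _ → true) ↪ ⟦ D ⟧ᶜʷ
  δ = doubleCW-↪ e (λ _ → true)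

  ι : G ⊑ cwAdj D
  ι = ⊑-↪ (iso⇒⊑ iso) δ

  c⁻ c⁺ : Fin 2
  c⁻ = tag {1} false zero
  c⁺ = tag {1} true zero

  c⁺≢c⁻ : c⁺ ≢ c⁻
  c⁺≢c⁻ = tag-sign-≢ {s = true} {false} λ ()

  U S K : CWExpr 2
  U = D ⊕ vtx c⁻
  S = η c⁺ c⁻ c⁺≢c⁻ U
  K = S ⊕ D

  m : ℕ
  m = cwSize D

  module U = Join (cw-⊕-join D (vtx c⁻))
  module K = Join (cw-⊕-join S D)

  u : Fin (size G) → Fin (cwSize U)
  u i = pos ι i ↑ˡ 1

  v : Fin (cwSize U)
  v = m ↑ʳ zero

  copy : Bool → Fin m → Fin (cwSize K)
  copy true  x = (x ↑ˡ 1) ↑ˡ m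
  copy false x = (m + 1) ↑ʳ x

  copy-injective : ∀ s t {x y} → copy s x ≡ copy t y → x ≡ y
  copy-injective true  true  eq = ↑ˡ-injective 1 _ _ (↑ˡ-injective m _ _ eq)
  copy-injective false false eq = ↑ʳ-injective (m + 1) _ _ eq
  copy-injective true  false eq = ⊥-elim (↑ˡ≢↑ʳ _ _ eq)
  copy-injective false true  eq = ⊥-elim (↑ˡ≢↑ʳ _ _ (sym eq))

  copy≢apex : ∀ s x → copy s x ≢ v ↑ˡ m
  copy≢apex true  x eq = ↑ˡ≢↑ʳ x zero (↑ˡ-injective m _ _ eq)
  copy≢apex false x eq = ↑ˡ≢↑ʳ _ x (sym eq)

  label-old : ∀ i → cwLab U (u i) ≡ c⁺
  label-old i rewrite U.labels-l (pos ι i) | sym (map-label δ (to i)) = cong (tag true) (the-label (cwLab e (to i)))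
    where
    the-label : (a : Fin 1) → a ≡ zero
    the-label zero = refl

  label≢c⁻ : ∀ i → cwLab U (u i) ≢ c⁻
  label≢c⁻ i rewrite label-old i = c⁺≢c⁻

  old-is-c⁺ : ∀ i → (cwLab U (u i) == c⁺) ≡ true
  old-is-c⁺ i rewrite label-old i = ==-refl c⁺

  star-old-apex : ∀ i → cwAdj S (u i) v ≡ true
  star-old-apex i rewrite U.edges-lr (pos ι i) zero | U.labels-r zero =
    trans (η-edge-into (label≢c⁻ i)) (old-is-c⁺ i)

  star-apex-old : ∀ i → cwAdj S v (u i) ≡ true
  star-apex-old i rewrite U.edges-rl (pos ι i) zero | U.labels-r zero =
    trans (η-edge-from (c⁺≢c⁻ ∘ sym) (cwLab U (u i))) (old-is-c⁺ i)

  star-apex-apex : cwAdj S v v ≡ false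
  star-apex-apex rewrite U.edges-rr zero zero | U.labels-r zero = η-edge-self (c⁺≢c⁻ ∘ sym)

  edgeless : ∀ i j → adj G i j ≡ false
  edgeless i j = trans (IsoTo.pres iso i j) (cw₁-edgeless e _ _)

  old-old : ∀ i j → cwAdj K (copy (N i) (pos ι i)) (copy (N j) (pos ι j)) ≡ adj G i j
  old-old i j with N i | N j
  ... | true  | true  = begin
    cwAdj K (u i ↑ˡ m) (u j ↑ˡ m)  ≡⟨ K.edges-ll (u i) (u j) ⟩
    cwAdj S (u i) (u j)            ≡⟨ η-edge-away _ (label≢c⁻ i) (label≢c⁻ j) ⟩
    cwAdj U (u i) (u j)            ≡⟨ U.edges-ll (pos ι i) (pos ι j) ⟩
    cwAdj D (pos ι i) (pos ι j)    ≡⟨ pos-adj ι i j ⟨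
    adj G i j                      ∎
    where open ≡-Reasoning
  ... | false | false = trans (K.edges-rr (pos ι i) (pos ι j)) (sym (pos-adj ι i j))
  ... | true  | false = trans (K.edges-lr (u i) (pos ι j)) (sym (edgeless i j))
  ... | false | true  = trans (K.edges-rl (u j) (pos ι i)) (sym (edgeless i j))

  old-apex : ∀ i → cwAdj K (copy (N i) (pos ι i)) (v ↑ˡ m) ≡ N i
  old-apex i with N i
  ... | true  = trans (K.edges-ll (u i) v) (star-old-apex i)
  ... | false = K.edges-rl v (pos ι i)

  apex-old : ∀ i → cwAdj K (v ↑ˡ m) (copy (N i) (pos ι i)) ≡ N i
  apex-old i with N i
  ... | true  = trans (K.edges-ll v (u i)) (star-apex-old i)
  ... | false = K.edges-lr v (pos ι i)

  extension : ApexEmbedding G N (cwAdj K)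
  extension = record
    { old           = λ i → copy (N i) (pos ι i)
    ; apex          = v ↑ˡ m
    ; old-injective = λ {i} {j} eq → pos-injective ι (copy-injective (N i) (N j) eq)
    ; old≢apex      = λ i → copy≢apex (N i) (pos ι i)
    ; old-old       = old-old
    ; old-apex      = old-apex
    ; apex-old      = apex-old
    ; apex-apex     = trans (K.edges-ll v v) star-apex-apex
    }

InCW-addVertex⁺ : ∀ {G} N k → InCW G k → InCW (addVertex G N) (2 * k)
InCW-addVertex⁺ N zero (e , _) with cwLab e (cw-vertex e)
... | ()
InCW-addVertex⁺ N 1 (e , iso) = ⊑⇒InCW K (apex⇒⊑ extension) zero
  where open CW₁Extension N e iso
InCW-addVertex⁺ N (suc (suc k)) (e , iso) = ⊑⇒InCW K (apex⇒⊑ extension) zero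
  where open CWExtension N e iso

theorem11 : (G : Graph) (N : Fin (size G) → Bool) →
    ((a b : ℕ) → IsNLCW G a → IsNLCW (addVertex G N) b → a ≤ b × b ≤ 2 * a)
    × ((a b : ℕ) → IsCW G a → IsCW (addVertex G N) b → a ≤ b × b ≤ 2 * a)
theorem11 G N =
  (λ a b (G∈a , a-least) (H∈b , b-least) →
     a-least b (InNLC-addVertex⁻ H∈b (InNLC-vertex G∈a)) , b-least (2 * a) (InNLC-addVertex⁺ N G∈a)) ,
  (λ a b (G∈a , a-least) (H∈b , b-least) →
     a-least b (InCW-addVertex⁻ H∈b (InCW-vertex G∈a)) , b-least (2 * a) (InCW-addVertex⁺ N a G∈a))
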